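{- For every natural number $n \geq 0$, $$G_n = \sum_{1 \leq \ell \leq k \leq n} (-1)^{k-1} (\ell-1)!\,(k-\ell)!\,S(n,k).$$ In particular, $G_n$ is an integer for every natural number $n$.
   Context: The Genocchi numbers $G_n$ ($n \geq 0$) are defined by the exponential generating function $\frac{2x}{e^x+1} = \sum_{n=0}^{\infty} G_n \frac{x^n}{n!}$. The Stirling numbers of the second kind $S(n,k)$ ($0 \leq k \leq n$) are the integers defined by $X^n = \sum_{k=0}^{n} S(n,k)\, X(X-1)\cdots(X-k+1)$. For $n=0$ the sum is empty (equal to $0$). -}

module Defs where

open import Data.Nat as ℕ using (ℕ; zero; suc; _∸_; _!)
open import Data.Nat.Combinatorics using (_C_)
open import Data.Integer as ℤ using (ℤ; +_; -_; _^_)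
open import Data.Rational as ℚ using (ℚ; 0ℚ; 1ℚ)
open import Relation.Binary.PropositionalEquality using (_≡_)

toℚ : ℤ → ℚ
toℚ z = z ℚ./ 1

Σ0ℚ : ℕ → (ℕ → ℚ) → ℚ
Σ0ℚ zero    f = f 0
Σ0ℚ (suc n) f = Σ0ℚ n f ℚ.+ f (suc n)

Σ0ℤ : ℕ → (ℕ → ℤ) → ℤ
Σ0ℤ zero    f = f 0
Σ0ℤ (suc n) f = Σ0ℤ n f ℤ.+ f (suc n)

Σ1ℤ : ℕ → (ℕ → ℤ) → ℤ
Σ1ℤ zero    f = + 0
Σ1ℤ (suc n) f = Σ1ℤ n f ℤ.+ f (suc n)

-- Exponential generating functions, represented by their sequence of
-- EGF-coefficients a : ℕ → ℚ  (the series  Σ a n x^n / n!).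

_⋆_ : (ℕ → ℚ) → (ℕ → ℚ) → (ℕ → ℚ)
(a ⋆ b) n = Σ0ℚ n (λ i → toℚ (+ (n C i)) ℚ.* a i ℚ.* b (n ∸ i))

expPlusOne : ℕ → ℚ
expPlusOne zero    = toℚ (+ 2)
expPlusOne (suc _) = 1ℚ

twoX : ℕ → ℚ
twoX 1 = toℚ (+ 2)
twoX _ = 0ℚ

-- G is the Genocchi sequence: its EGF G(x) satisfies (e^x + 1) G(x) = 2x,
-- i.e. G(x) = 2x/(e^x+1)  (e^x + 1 is invertible as a power series).
IsGenocchi : (ℕ → ℚ) → Set
IsGenocchi G = ∀ n → (expPlusOne ⋆ G) n ≡ twoX n

-- Stirling numbers of the second kind, by their defining identity
-- X^n = Σ_{k=0}^{n} S(n,k) X(X-1)...(X-k+1)  (as polynomial identity in ℤ[X],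
-- equivalently for every integer value X).

falling : ℤ → ℕ → ℤ
falling x zero    = + 1
falling x (suc k) = falling x k ℤ.* (x ℤ.- + k)

IsStirling2 : (ℕ → ℕ → ℤ) → Set
IsStirling2 S = ∀ (n : ℕ) (x : ℤ) → x ^ n ≡ Σ0ℤ n (λ k → S n k ℤ.* falling x k)

genocchiRHS : (ℕ → ℕ → ℤ) → ℕ → ℤ
genocchiRHS S n =
  Σ1ℤ n (λ k → Σ1ℤ k (λ ℓ →
    ((- + 1) ^ (k ∸ 1)) ℤ.* + ((ℓ ∸ 1) !) ℤ.* + ((k ∸ ℓ) !) ℤ.* S n k))

-- Write y = e^x − 1. If g has EGF g(y) = Σ_k g_k y^k/k!, then Σ_k g_k S(n,k) is
-- the n-th EGF coefficient of g(e^x − 1). Substituting x = log(1+y), the theorem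
-- says that c_k = Σ_ℓ (−1)^(k−1) (ℓ−1)! (k−ℓ)! are the coefficients of
-- C(y) = 2 log(1+y)/(2+y). That is the identity (2+y) C(y) = 2 log(1+y), i.e.
-- 2 c_k + k c_(k−1) = 2 (−1)^(k−1) (k−1)!, which reduces to
-- 2 b_(k+1) = (k+2) b_k + 2 (k+1)! for b_k = Σ_j j! (k−j)!. Multiplying by e^x
-- becomes a binomial sum, so (e^x + 1) C(e^x − 1) = 2x holds coefficientwise,
-- and 2x/(e^x + 1) is its only solution. Any S with X^n = Σ_k S(n,k) X(X−1)⋯
-- is the usual Stirling triangle, as the falling factorials are independent.
module Submission where

open import Defs
open import Data.Nat as ℕ using (ℕ; zero; suc; _∸_; _!; _≤_; _<_; z≤n; s≤s)
import Data.Nat.Properties as ℕP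
open import Data.Nat.Combinatorics
  using (_C_; nCk+nC[k+1]≡[n+1]C[k+1]; k>n⇒nCk≡0; nCk≡nC[n∸k])
open import Data.Nat.Induction using (<-rec)
open import Data.Integer as ℤ using (ℤ; +_; -_; _^_)
import Data.Integer.Properties as ℤP
open import Algebra.Properties.CommutativeSemigroup ℤP.+-commutativeSemigroup
  using (interchange)
open import Data.Integer.Tactic.RingSolver using (solve-∀)
open import Data.Rational as ℚ using (ℚ; 1ℚ)
import Data.Rational.Properties as ℚP
open import Algebra.Properties.Group ℚP.+-0-group using (∙-cancelʳ)
import Data.Rational.Unnormalised as ℚᵘ
import Data.Rational.Unnormalised.Properties as ℚᵘP
open import Function using (_∘_)
open import Relation.Binary.PropositionalEquality
open ≡-Reasoning

Σ0ℤ-cong : ∀ n {f g : ℕ → ℤ} → (∀ i → i ≤ n → f i ≡ g i) → Σ0ℤ n f ≡ Σ0ℤ n g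
Σ0ℤ-cong zero    f≗g = f≗g 0 z≤n
Σ0ℤ-cong (suc n) f≗g =
  cong₂ ℤ._+_ (Σ0ℤ-cong n (λ i → f≗g i ∘ ℕP.m≤n⇒m≤1+n)) (f≗g (suc n) ℕP.≤-refl)

Σ0ℤ-cong′ : ∀ n {f g : ℕ → ℤ} → (∀ i → f i ≡ g i) → Σ0ℤ n f ≡ Σ0ℤ n g
Σ0ℤ-cong′ n f≗g = Σ0ℤ-cong n (λ i _ → f≗g i)

Σ0ℤ-distrib-+ : ∀ n (f g : ℕ → ℤ) →
                Σ0ℤ n (λ i → f i ℤ.+ g i) ≡ Σ0ℤ n f ℤ.+ Σ0ℤ n g
Σ0ℤ-distrib-+ zero    f g = refl
Σ0ℤ-distrib-+ (suc n) f g = trans (cong (ℤ._+ (f (suc n) ℤ.+ g (suc n))) (Σ0ℤ-distrib-+ n f g))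
                                  (interchange (Σ0ℤ n f) (Σ0ℤ n g) (f (suc n)) (g (suc n)))

Σ0ℤ-distrib-- : ∀ n (f g : ℕ → ℤ) →
                Σ0ℤ n (λ i → f i ℤ.- g i) ≡ Σ0ℤ n f ℤ.- Σ0ℤ n g
Σ0ℤ-distrib-- zero    f g = refl
Σ0ℤ-distrib-- (suc n) f g = trans (cong (ℤ._+ (f (suc n) ℤ.- g (suc n))) (Σ0ℤ-distrib-- n f g))
                                  (shuffle (Σ0ℤ n f) (Σ0ℤ n g) (f (suc n)) (g (suc n)))
  where
  shuffle : ∀ a b c d → (a ℤ.- b) ℤ.+ (c ℤ.- d) ≡ (a ℤ.+ c) ℤ.- (b ℤ.+ d)
  shuffle = solve-∀

Σ0ℤ-*ˡ : ∀ n a (f : ℕ → ℤ) → Σ0ℤ n (λ i → a ℤ.* f i) ≡ a ℤ.* Σ0ℤ n f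
Σ0ℤ-*ˡ zero    a f = refl
Σ0ℤ-*ˡ (suc n) a f = trans (cong (ℤ._+ a ℤ.* f (suc n)) (Σ0ℤ-*ˡ n a f))
                           (sym (ℤP.*-distribˡ-+ a (Σ0ℤ n f) (f (suc n))))

Σ0ℤ-head : ∀ n (f : ℕ → ℤ) → Σ0ℤ (suc n) f ≡ f 0 ℤ.+ Σ0ℤ n (f ∘ suc)
Σ0ℤ-head zero    f = refl
Σ0ℤ-head (suc n) f = trans (cong (ℤ._+ f (2 ℕ.+ n)) (Σ0ℤ-head n f)) (ℤP.+-assoc (f 0) _ _)

Σ0ℤ-tail : ∀ n (f : ℕ → ℤ) → f 0 ≡ + 0 → Σ0ℤ (suc n) f ≡ Σ0ℤ n (f ∘ suc)
Σ0ℤ-tail n f f0≡0 = trans (Σ0ℤ-head n f) (trans (cong (ℤ._+ Σ0ℤ n (f ∘ suc)) f0≡0) (ℤP.+-identityˡ _))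

Σ0ℤ-init : ∀ n (f : ℕ → ℤ) → (∀ i → f (suc i) ≡ + 0) → Σ0ℤ n f ≡ f 0
Σ0ℤ-init zero    f _      = refl
Σ0ℤ-init (suc n) f f∘suc≡0 =
  trans (cong₂ ℤ._+_ (Σ0ℤ-init n f f∘suc≡0) (f∘suc≡0 n)) (ℤP.+-identityʳ (f 0))

Σ0ℤ-shift : ∀ n (f : ℕ → ℤ) → f 0 ≡ + 0 → f (suc n) ≡ + 0 → Σ0ℤ n (f ∘ suc) ≡ Σ0ℤ n f
Σ0ℤ-shift n f f0≡0 fn≡0 = begin
  Σ0ℤ n (f ∘ suc)            ≡⟨ Σ0ℤ-tail n f f0≡0 ⟨
  Σ0ℤ n f ℤ.+ f (suc n)      ≡⟨ cong (ℤ._+_ (Σ0ℤ n f)) fn≡0 ⟩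
  Σ0ℤ n f ℤ.+ + 0            ≡⟨ ℤP.+-identityʳ _ ⟩
  Σ0ℤ n f                    ∎

Σ0ℤ-reverse : ∀ n (f : ℕ → ℤ) → Σ0ℤ n (λ i → f (n ∸ i)) ≡ Σ0ℤ n f
Σ0ℤ-reverse zero    f = refl
Σ0ℤ-reverse (suc n) f = begin
  Σ0ℤ (suc n) (λ i → f (suc n ∸ i))            ≡⟨ Σ0ℤ-head n _ ⟩
  f (suc n) ℤ.+ Σ0ℤ n (λ i → f (n ∸ i))        ≡⟨ cong (ℤ._+_ (f (suc n))) (Σ0ℤ-reverse n f) ⟩
  f (suc n) ℤ.+ Σ0ℤ n f                        ≡⟨ ℤP.+-comm (f (suc n)) _ ⟩
  Σ0ℤ (suc n) f                                ∎

Σ0ℤ≡head+Σ1ℤ : ∀ n (f : ℕ → ℤ) → Σ0ℤ n f ≡ f 0 ℤ.+ Σ1ℤ n f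
Σ0ℤ≡head+Σ1ℤ zero    f = sym (ℤP.+-identityʳ (f 0))
Σ0ℤ≡head+Σ1ℤ (suc n) f = trans (cong (ℤ._+ f (suc n)) (Σ0ℤ≡head+Σ1ℤ n f)) (ℤP.+-assoc (f 0) _ _)

Σ1ℤ-suc : ∀ n (f : ℕ → ℤ) → Σ1ℤ (suc n) f ≡ Σ0ℤ n (f ∘ suc)
Σ1ℤ-suc zero    f = ℤP.+-identityˡ (f 1)
Σ1ℤ-suc (suc n) f = cong (ℤ._+ f (2 ℕ.+ n)) (Σ1ℤ-suc n f)

Σ1ℤ-cong : ∀ n {f g : ℕ → ℤ} → (∀ i → i ≤ n → f i ≡ g i) → Σ1ℤ n f ≡ Σ1ℤ n g
Σ1ℤ-cong zero    f≗g = refl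
Σ1ℤ-cong (suc n) f≗g =
  cong₂ ℤ._+_ (Σ1ℤ-cong n (λ i → f≗g i ∘ ℕP.m≤n⇒m≤1+n)) (f≗g (suc n) ℕP.≤-refl)

Σ1ℤ-*ʳ : ∀ n (f : ℕ → ℤ) a → Σ1ℤ n (λ i → f i ℤ.* a) ≡ Σ1ℤ n f ℤ.* a
Σ1ℤ-*ʳ zero    f a = refl
Σ1ℤ-*ʳ (suc n) f a = trans (cong (ℤ._+ f (suc n) ℤ.* a) (Σ1ℤ-*ʳ n f a))
                           (sym (ℤP.*-distribʳ-+ a (Σ1ℤ n f) (f (suc n))))

Σ0ℚ-cong : ∀ n {f g : ℕ → ℚ} → (∀ i → f i ≡ g i) → Σ0ℚ n f ≡ Σ0ℚ n g
Σ0ℚ-cong zero    f≗g = f≗g 0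
Σ0ℚ-cong (suc n) f≗g = cong₂ ℚ._+_ (Σ0ℚ-cong n f≗g) (f≗g (suc n))

Σ0ℚ-head : ∀ n (f : ℕ → ℚ) → Σ0ℚ (suc n) f ≡ f 0 ℚ.+ Σ0ℚ n (f ∘ suc)
Σ0ℚ-head zero    f = refl
Σ0ℚ-head (suc n) f = trans (cong (ℚ._+ f (2 ℕ.+ n)) (Σ0ℚ-head n f)) (ℚP.+-assoc (f 0) _ _)

binomialSum : ℕ → (ℕ → ℤ) → ℤ
binomialSum n a = Σ0ℤ n (λ j → + (n C j) ℤ.* a j)

binomialSum-reverse : ∀ n a → binomialSum n (λ i → a (n ∸ i)) ≡ binomialSum n a
binomialSum-reverse n a = begin
  binomialSum n (λ i → a (n ∸ i))           ≡⟨ Σ0ℤ-cong n symmetry ⟩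
  Σ0ℤ n (λ i → + (n C (n ∸ i)) ℤ.* a (n ∸ i)) ≡⟨ Σ0ℤ-reverse n (λ j → + (n C j) ℤ.* a j) ⟩
  binomialSum n a                           ∎
  where
  symmetry : ∀ i → i ≤ n → + (n C i) ℤ.* a (n ∸ i) ≡ + (n C (n ∸ i)) ℤ.* a (n ∸ i)
  symmetry i i≤n = cong (λ m → + m ℤ.* a (n ∸ i)) (nCk≡nC[n∸k] i≤n)

binomialSum-suc : ∀ n a → binomialSum (suc n) a ≡ binomialSum n a ℤ.+ binomialSum n (a ∘ suc)
binomialSum-suc n a = begin
  binomialSum (suc n) a
    ≡⟨ Σ0ℤ-head n _ ⟩
  + 1 ℤ.* a 0 ℤ.+ Σ0ℤ n (λ j → + (suc n C suc j) ℤ.* a (suc j))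
    ≡⟨ cong (ℤ._+_ (+ 1 ℤ.* a 0)) (trans (Σ0ℤ-cong′ n pascal) (Σ0ℤ-distrib-+ n X Y)) ⟩
  + 1 ℤ.* a 0 ℤ.+ (Σ0ℤ n X ℤ.+ Σ0ℤ n Y)
    ≡⟨ rearrange (+ 1 ℤ.* a 0) (Σ0ℤ n X) (Σ0ℤ n Y) ⟩
  (+ 1 ℤ.* a 0 ℤ.+ Σ0ℤ n Y) ℤ.+ Σ0ℤ n X
    ≡⟨ cong (ℤ._+ Σ0ℤ n X) (Σ0ℤ-head n (λ j → + (n C j) ℤ.* a j)) ⟨
  Σ0ℤ (suc n) (λ j → + (n C j) ℤ.* a j) ℤ.+ Σ0ℤ n X
    ≡⟨ cong (ℤ._+ Σ0ℤ n X) top-vanishes ⟩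
  binomialSum n a ℤ.+ binomialSum n (a ∘ suc)
    ∎
  where
  X Y : ℕ → ℤ
  X j = + (n C j) ℤ.* a (suc j)
  Y j = + (n C suc j) ℤ.* a (suc j)
  pascal : ∀ j → + (suc n C suc j) ℤ.* a (suc j) ≡ X j ℤ.+ Y j
  pascal j = begin
    + (suc n C suc j) ℤ.* a (suc j)             ≡⟨ cong (λ m → + m ℤ.* a (suc j)) (nCk+nC[k+1]≡[n+1]C[k+1] n j) ⟨
    + (n C j ℕ.+ n C suc j) ℤ.* a (suc j)       ≡⟨ cong (ℤ._* a (suc j)) (ℤP.pos-+ (n C j) (n C suc j)) ⟩
    (+ (n C j) ℤ.+ + (n C suc j)) ℤ.* a (suc j) ≡⟨ ℤP.*-distribʳ-+ (a (suc j)) (+ (n C j)) (+ (n C suc j)) ⟩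
    X j ℤ.+ Y j                                 ∎
  rearrange : ∀ h x y → h ℤ.+ (x ℤ.+ y) ≡ (h ℤ.+ y) ℤ.+ x
  rearrange = solve-∀
  top-vanishes : Σ0ℤ (suc n) (λ j → + (n C j) ℤ.* a j) ≡ binomialSum n a
  top-vanishes = begin
    binomialSum n a ℤ.+ + (n C suc n) ℤ.* a (suc n) ≡⟨ cong (λ m → binomialSum n a ℤ.+ + m ℤ.* a (suc n))
                                                             (k>n⇒nCk≡0 (ℕP.n<1+n n)) ⟩
    binomialSum n a ℤ.+ + 0                         ≡⟨ ℤP.+-identityʳ _ ⟩
    binomialSum n a                                 ∎

stirling₂ : ℕ → ℕ → ℤ
stirling₂ zero    zero    = + 1
stirling₂ zero    (suc k) = + 0
stirling₂ (suc n) zero    = + 0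
stirling₂ (suc n) (suc k) = stirling₂ n k ℤ.+ + suc k ℤ.* stirling₂ n (suc k)

k>n⇒stirling₂≡0 : ∀ {n k} → n < k → stirling₂ n k ≡ + 0
k>n⇒stirling₂≡0 {zero}  {suc k} _       = refl
k>n⇒stirling₂≡0 {suc n} {suc k} (s≤s n<k)
  rewrite k>n⇒stirling₂≡0 n<k | k>n⇒stirling₂≡0 (ℕP.m≤n⇒m≤1+n n<k) =
  trans (ℤP.+-identityˡ _) (ℤP.*-zeroʳ (+ suc k))

stirlingSum : ℕ → (ℕ → ℤ) → ℤ
stirlingSum m g = Σ0ℤ m (λ k → g k ℤ.* stirling₂ m k)

stirlingStep : (ℕ → ℤ) → ℕ → ℤ
stirlingStep g k = g (suc k) ℤ.+ + k ℤ.* g k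

stirlingSum-cong : ∀ m {g h : ℕ → ℤ} → (∀ k → k ≤ m → g k ≡ h k) → stirlingSum m g ≡ stirlingSum m h
stirlingSum-cong m g≗h = Σ0ℤ-cong m (λ k k≤m → cong (ℤ._* stirling₂ m k) (g≗h k k≤m))

stirlingSum-suc-cong : ∀ m {g h : ℕ → ℤ} → (∀ k → g (suc k) ≡ h (suc k)) →
                       stirlingSum (suc m) g ≡ stirlingSum (suc m) h
stirlingSum-suc-cong m {g} {h} g≗h = begin
  stirlingSum (suc m) g                                  ≡⟨ Σ0ℤ-tail m _ (ℤP.*-zeroʳ (g 0)) ⟩
  Σ0ℤ m (λ k → g (suc k) ℤ.* stirling₂ (suc m) (suc k)) ≡⟨ Σ0ℤ-cong′ m (λ k → cong (ℤ._* _) (g≗h k)) ⟩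
  Σ0ℤ m (λ k → h (suc k) ℤ.* stirling₂ (suc m) (suc k)) ≡⟨ Σ0ℤ-tail m _ (ℤP.*-zeroʳ (h 0)) ⟨
  stirlingSum (suc m) h                                  ∎

stirlingSum-distrib-+ : ∀ m g h → stirlingSum m (λ k → g k ℤ.+ h k) ≡ stirlingSum m g ℤ.+ stirlingSum m h
stirlingSum-distrib-+ m g h =
  trans (Σ0ℤ-cong′ m (λ k → ℤP.*-distribʳ-+ (stirling₂ m k) (g k) (h k))) (Σ0ℤ-distrib-+ m _ _)

stirlingSum-*ˡ : ∀ m a g → stirlingSum m (λ k → a ℤ.* g k) ≡ a ℤ.* stirlingSum m g
stirlingSum-*ˡ m a g = trans (Σ0ℤ-cong′ m (λ k → ℤP.*-assoc a (g k) _)) (Σ0ℤ-*ˡ m a _)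

stirlingSum-suc : ∀ m g → stirlingSum (suc m) g ≡ stirlingSum m (stirlingStep g)
stirlingSum-suc m g = begin
  stirlingSum (suc m) g                            ≡⟨ Σ0ℤ-tail m _ (ℤP.*-zeroʳ (g 0)) ⟩
  Σ0ℤ m (λ k → g (suc k) ℤ.* stirling₂ (suc m) (suc k))
                                                   ≡⟨ Σ0ℤ-cong′ m (λ k → distrib (g (suc k)) _ (+ k) _) ⟩
  Σ0ℤ m (λ k → A k ℤ.+ B (suc k))                 ≡⟨ Σ0ℤ-distrib-+ m A (B ∘ suc) ⟩
  Σ0ℤ m A ℤ.+ Σ0ℤ m (B ∘ suc)                     ≡⟨ cong (ℤ._+_ (Σ0ℤ m A)) (Σ0ℤ-shift m B refl B[1+m]≡0) ⟩
  Σ0ℤ m A ℤ.+ Σ0ℤ m B                             ≡⟨ Σ0ℤ-distrib-+ m A B ⟨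
  Σ0ℤ m (λ k → A k ℤ.+ B k)
                              ≡⟨ Σ0ℤ-cong′ m (λ k → ℤP.*-distribʳ-+ (stirling₂ m k) (g (suc k)) (+ k ℤ.* g k)) ⟨
  stirlingSum m (stirlingStep g)                   ∎
  where
  A B : ℕ → ℤ
  A k = g (suc k) ℤ.* stirling₂ m k
  B k = (+ k ℤ.* g k) ℤ.* stirling₂ m k
  distrib : ∀ x s k t → x ℤ.* (s ℤ.+ (+ 1 ℤ.+ k) ℤ.* t) ≡ x ℤ.* s ℤ.+ ((+ 1 ℤ.+ k) ℤ.* x) ℤ.* t
  distrib = solve-∀
  B[1+m]≡0 : B (suc m) ≡ + 0
  B[1+m]≡0 = trans (cong (ℤ._*_ (+ suc m ℤ.* g (suc m))) (k>n⇒stirling₂≡0 (ℕP.n<1+n m)))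
                   (ℤP.*-zeroʳ (+ suc m ℤ.* g (suc m)))

shiftʳ : (ℕ → ℤ) → ℕ → ℤ
shiftʳ g zero    = + 0
shiftʳ g (suc k) = g k

-- The transform of Σ_j C(n,j) S(j,k) = S(n+1,k+1).
binomialSum-stirlingSum : ∀ n g → binomialSum n (λ j → stirlingSum j g) ≡ stirlingSum (suc n) (shiftʳ g)
binomialSum-stirlingSum zero    g = trans (ℤP.*-identityˡ _) (sym (ℤP.+-identityˡ _))
binomialSum-stirlingSum (suc n) g = begin
  binomialSum (suc n) (λ j → stirlingSum j g)
    ≡⟨ binomialSum-suc n _ ⟩
  binomialSum n (λ j → stirlingSum j g) ℤ.+ binomialSum n (λ j → stirlingSum (suc j) g)
    ≡⟨ cong₂ ℤ._+_ (binomialSum-stirlingSum n g)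
                   (trans (Σ0ℤ-cong′ n (λ j → cong (ℤ._*_ (+ (n C j))) (stirlingSum-suc j g)))
                          (binomialSum-stirlingSum n (stirlingStep g))) ⟩
  stirlingSum (suc n) (shiftʳ g) ℤ.+ stirlingSum (suc n) (shiftʳ (stirlingStep g))
    ≡⟨ stirlingSum-distrib-+ (suc n) (shiftʳ g) (shiftʳ (stirlingStep g)) ⟨
  stirlingSum (suc n) (λ k → shiftʳ g k ℤ.+ shiftʳ (stirlingStep g) k)
    ≡⟨ stirlingSum-suc-cong n {λ k → shiftʳ g k ℤ.+ shiftʳ (stirlingStep g) k} {stirlingStep (shiftʳ g)}
                             (λ k → step-shiftʳ (g k) (g (suc k)) (+ k)) ⟩
  stirlingSum (suc n) (stirlingStep (shiftʳ g))
    ≡⟨ stirlingSum-suc (suc n) (shiftʳ g) ⟨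
  stirlingSum (suc (suc n)) (shiftʳ g)
    ∎
  where
  step-shiftʳ : ∀ a b k → a ℤ.+ (b ℤ.+ k ℤ.* a) ≡ b ℤ.+ (+ 1 ℤ.+ k) ℤ.* a
  step-shiftʳ = solve-∀

falling-suc′ : ∀ x k → falling x (suc k) ≡ x ℤ.* falling (x ℤ.- + 1) k
falling-suc′ x zero    = base x
  where
  base : ∀ x → + 1 ℤ.* (x ℤ.- + 0) ≡ x ℤ.* + 1
  base = solve-∀
falling-suc′ x (suc k) = begin
  falling x (suc k) ℤ.* (x ℤ.- + suc k)             ≡⟨ cong (ℤ._* (x ℤ.- + suc k)) (falling-suc′ x k) ⟩
  x ℤ.* falling (x ℤ.- + 1) k ℤ.* (x ℤ.- + suc k)   ≡⟨ reassoc x (falling (x ℤ.- + 1) k) (+ k) ⟩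
  x ℤ.* falling (x ℤ.- + 1) (suc k)                 ∎
  where
  reassoc : ∀ x f k → x ℤ.* f ℤ.* (x ℤ.- (+ 1 ℤ.+ k)) ≡ x ℤ.* (f ℤ.* ((x ℤ.- + 1) ℤ.- k))
  reassoc = solve-∀

stirlingStep-falling : ∀ x k → stirlingStep (falling x) k ≡ x ℤ.* falling x k
stirlingStep-falling x k = expand x (falling x k) (+ k)
  where
  expand : ∀ x f k → f ℤ.* (x ℤ.- k) ℤ.+ k ℤ.* f ≡ x ℤ.* f
  expand = solve-∀

stirlingSum-falling : ∀ n x → stirlingSum n (falling x) ≡ x ^ n
stirlingSum-falling zero    x = refl
stirlingSum-falling (suc n) x = begin
  stirlingSum (suc n) (falling x)           ≡⟨ stirlingSum-suc n (falling x) ⟩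
  stirlingSum n (stirlingStep (falling x))  ≡⟨ stirlingSum-cong n (λ k _ → stirlingStep-falling x k) ⟩
  stirlingSum n (λ k → x ℤ.* falling x k)   ≡⟨ stirlingSum-*ˡ n x (falling x) ⟩
  x ℤ.* stirlingSum n (falling x)           ≡⟨ cong (ℤ._*_ x) (stirlingSum-falling n x) ⟩
  x ^ suc n                                 ∎

Σ-falling-zero : ∀ n (e : ℕ → ℤ) → Σ0ℤ n (λ k → e k ℤ.* falling (+ 0) k) ≡ e 0
Σ-falling-zero n e = trans (Σ0ℤ-init n _ vanish) (ℤP.*-identityʳ (e 0))
  where
  vanish : ∀ k → e (suc k) ℤ.* falling (+ 0) (suc k) ≡ + 0
  vanish k = trans (cong (ℤ._*_ (e (suc k))) (falling-suc′ (+ 0) k)) (ℤP.*-zeroʳ (e (suc k)))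

Σ-falling-suc : ∀ n (e : ℕ → ℤ) m →
                Σ0ℤ (suc n) (λ k → e k ℤ.* falling (+ suc m) k)
                ≡ e 0 ℤ.+ + suc m ℤ.* Σ0ℤ n (λ k → e (suc k) ℤ.* falling (+ m) k)
Σ-falling-suc n e m = trans (Σ0ℤ-head n _)
  (cong₂ ℤ._+_ (ℤP.*-identityʳ (e 0)) (trans (Σ0ℤ-cong′ n pull) (Σ0ℤ-*ˡ n (+ suc m) _)))
  where
  swap : ∀ a x y → a ℤ.* (x ℤ.* y) ≡ x ℤ.* (a ℤ.* y)
  swap = solve-∀
  pull : ∀ k → e (suc k) ℤ.* falling (+ suc m) (suc k) ≡ + suc m ℤ.* (e (suc k) ℤ.* falling (+ m) k)
  pull k = trans (cong (ℤ._*_ (e (suc k))) (falling-suc′ (+ suc m) k)) (swap (e (suc k)) (+ suc m) _)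

-- At X = 0 only e 0 survives; at X = m+1 the rest is (m+1) times the sum for e ∘ suc at X = m.
falling-independent : ∀ n (e : ℕ → ℤ) → (∀ m → Σ0ℤ n (λ k → e k ℤ.* falling (+ m) k) ≡ + 0) →
                      ∀ k → k ≤ n → e k ≡ + 0
falling-independent n       e vanish zero    _         = trans (sym (Σ-falling-zero n e)) (vanish 0)
falling-independent (suc n) e vanish (suc k) (s≤s k≤n) = falling-independent n (e ∘ suc) vanish′ k k≤n
  where
  e0≡0 : e 0 ≡ + 0
  e0≡0 = trans (sym (Σ-falling-zero (suc n) e)) (vanish 0)
  vanish′ : ∀ m → Σ0ℤ n (λ k → e (suc k) ℤ.* falling (+ m) k) ≡ + 0
  vanish′ m = ℤP.*-cancelˡ-≡ (+ suc m) T (+ 0) (begin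
    + suc m ℤ.* T                                    ≡⟨ ℤP.+-identityˡ _ ⟨
    + 0 ℤ.+ + suc m ℤ.* T                            ≡⟨ cong (ℤ._+ (+ suc m ℤ.* T)) e0≡0 ⟨
    e 0 ℤ.+ + suc m ℤ.* T                            ≡⟨ Σ-falling-suc n e m ⟨
    Σ0ℤ (suc n) (λ k → e k ℤ.* falling (+ suc m) k)  ≡⟨ vanish (suc m) ⟩
    + 0                                              ≡⟨ ℤP.*-zeroʳ (+ suc m) ⟨
    + suc m ℤ.* + 0                                  ∎)
    where
    T : ℤ
    T = Σ0ℤ n (λ k → e (suc k) ℤ.* falling (+ m) k)

IsStirling2⇒≡stirling₂ : ∀ {S} → IsStirling2 S → ∀ {n k} → k ≤ n → S n k ≡ stirling₂ n k
IsStirling2⇒≡stirling₂ {S} isS {n} {k} k≤n =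
  ℤP.i-j≡0⇒i≡j _ _ (falling-independent n (λ k → S n k ℤ.- stirling₂ n k) vanish k k≤n)
  where
  distrib : ∀ s t f → (s ℤ.- t) ℤ.* f ≡ s ℤ.* f ℤ.- f ℤ.* t
  distrib = solve-∀
  vanish : ∀ m → Σ0ℤ n (λ k → (S n k ℤ.- stirling₂ n k) ℤ.* falling (+ m) k) ≡ + 0
  vanish m = begin
    Σ0ℤ n (λ k → (S n k ℤ.- stirling₂ n k) ℤ.* falling (+ m) k)
      ≡⟨ Σ0ℤ-cong′ n (λ k → distrib (S n k) (stirling₂ n k) (falling (+ m) k)) ⟩
    Σ0ℤ n (λ k → S n k ℤ.* falling (+ m) k ℤ.- falling (+ m) k ℤ.* stirling₂ n k)
      ≡⟨ Σ0ℤ-distrib-- n _ _ ⟩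
    Σ0ℤ n (λ k → S n k ℤ.* falling (+ m) k) ℤ.- stirlingSum n (falling (+ m))
      ≡⟨ cong₂ ℤ._-_ (sym (isS n (+ m))) (stirlingSum-falling n (+ m)) ⟩
    (+ m) ^ n ℤ.- (+ m) ^ n
      ≡⟨ ℤP.+-inverseʳ ((+ m) ^ n) ⟩
    + 0
      ∎

genocchiCoeff : ℕ → ℤ
genocchiCoeff k = Σ1ℤ k (λ ℓ → ((- + 1) ^ (k ∸ 1)) ℤ.* + ((ℓ ∸ 1) !) ℤ.* + ((k ∸ ℓ) !))

genocchiRHS≡stirlingSum : ∀ {S} → IsStirling2 S → ∀ n → genocchiRHS S n ≡ stirlingSum n genocchiCoeff
genocchiRHS≡stirlingSum {S} isS n = begin
  genocchiRHS S n
    ≡⟨ Σ1ℤ-cong n (λ k k≤n → trans (Σ1ℤ-*ʳ k _ (S n k))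
                                    (cong (ℤ._*_ (genocchiCoeff k)) (IsStirling2⇒≡stirling₂ {S} isS k≤n))) ⟩
  Σ1ℤ n (λ k → genocchiCoeff k ℤ.* stirling₂ n k)
    ≡⟨ ℤP.+-identityˡ _ ⟨
  + 0 ℤ.+ Σ1ℤ n (λ k → genocchiCoeff k ℤ.* stirling₂ n k)
    ≡⟨ Σ0ℤ≡head+Σ1ℤ n _ ⟨
  stirlingSum n genocchiCoeff
    ∎

factorialConvolution : ℕ → ℤ
factorialConvolution m = Σ0ℤ m (λ j → + (j !) ℤ.* + ((m ∸ j) !))

genocchiCoeff-suc : ∀ m → genocchiCoeff (suc m) ≡ (- + 1) ^ m ℤ.* factorialConvolution m
genocchiCoeff-suc m = trans (Σ1ℤ-suc m _)
  (trans (Σ0ℤ-cong′ m (λ j → ℤP.*-assoc ((- + 1) ^ m) (+ (j !)) (+ ((m ∸ j) !))))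
         (Σ0ℤ-*ˡ m ((- + 1) ^ m) _))

factorial-split : ∀ {p j} → j ≤ p →
                  + (2 ℕ.+ p) ℤ.* (+ (j !) ℤ.* + ((p ∸ j) !))
                  ≡ + (suc j !) ℤ.* + ((p ∸ j) !) ℤ.+ + (j !) ℤ.* + ((suc p ∸ j) !)
factorial-split {p} {j} j≤p = begin
  + (2 ℕ.+ p) ℤ.* (j! ℤ.* q!)                   ≡⟨ cong (λ t → + t ℤ.* (j! ℤ.* q!)) 2+p≡ ⟩
  + (suc j ℕ.+ suc q) ℤ.* (j! ℤ.* q!)           ≡⟨ cong (ℤ._* (j! ℤ.* q!)) (ℤP.pos-+ (suc j) (suc q)) ⟩
  (+ suc j ℤ.+ + suc q) ℤ.* (j! ℤ.* q!)         ≡⟨ distrib (+ suc j) (+ suc q) j! q! ⟩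
  + suc j ℤ.* j! ℤ.* q! ℤ.+ j! ℤ.* (+ suc q ℤ.* q!)
    ≡⟨ cong₂ (λ x y → x ℤ.* q! ℤ.+ j! ℤ.* y) (ℤP.pos-* (suc j) (j !)) (ℤP.pos-* (suc q) (q !)) ⟨
  + (suc j !) ℤ.* q! ℤ.+ j! ℤ.* + (suc q !)     ≡⟨ cong (λ t → + (suc j !) ℤ.* q! ℤ.+ j! ℤ.* + (t !))
                                                     (ℕP.+-∸-assoc 1 j≤p) ⟨
  + (suc j !) ℤ.* q! ℤ.+ j! ℤ.* + ((suc p ∸ j) !) ∎
  where
  q : ℕ
  q = p ∸ j
  j! q! : ℤ
  j! = + (j !)
  q! = + (q !)
  2+p≡ : 2 ℕ.+ p ≡ suc j ℕ.+ suc q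
  2+p≡ = cong suc (sym (trans (ℕP.+-suc j q) (cong suc (ℕP.m+[n∸m]≡n j≤p))))
  distrib : ∀ a b x y → (a ℤ.+ b) ℤ.* (x ℤ.* y) ≡ a ℤ.* x ℤ.* y ℤ.+ x ℤ.* (b ℤ.* y)
  distrib = solve-∀

factorialConvolution-suc : ∀ p → + 2 ℤ.* factorialConvolution (suc p)
                                 ≡ + (2 ℕ.+ p) ℤ.* factorialConvolution p ℤ.+ + 2 ℤ.* + (suc p !)
factorialConvolution-suc p = begin
  + 2 ℤ.* B
    ≡⟨ double B ⟩
  B ℤ.+ B
    ≡⟨ cong (ℤ._+ B) (Σ0ℤ-head p F) ⟩
  (F 0 ℤ.+ Σ0ℤ p (F ∘ suc)) ℤ.+ (Σ0ℤ p F ℤ.+ F (suc p))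
    ≡⟨ cong₂ (λ x y → (x ℤ.+ Σ0ℤ p (F ∘ suc)) ℤ.+ (Σ0ℤ p F ℤ.+ y)) F-first F-last ⟩
  (fac ℤ.+ Σ0ℤ p (F ∘ suc)) ℤ.+ (Σ0ℤ p F ℤ.+ fac)
    ≡⟨ rearrange fac (Σ0ℤ p (F ∘ suc)) (Σ0ℤ p F) ⟩
  (Σ0ℤ p (F ∘ suc) ℤ.+ Σ0ℤ p F) ℤ.+ + 2 ℤ.* fac
    ≡⟨ cong (ℤ._+ + 2 ℤ.* fac) split ⟨
  + (2 ℕ.+ p) ℤ.* factorialConvolution p ℤ.+ + 2 ℤ.* fac
    ∎
  where
  B fac : ℤ
  B = factorialConvolution (suc p)
  fac = + (suc p !)
  F : ℕ → ℤ
  F j = + (j !) ℤ.* + ((suc p ∸ j) !)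
  F-first : F 0 ≡ fac
  F-first = ℤP.*-identityˡ fac
  F-last : F (suc p) ≡ fac
  F-last = trans (cong (λ t → fac ℤ.* + (t !)) (ℕP.n∸n≡0 p)) (ℤP.*-identityʳ fac)
  split : + (2 ℕ.+ p) ℤ.* factorialConvolution p ≡ Σ0ℤ p (F ∘ suc) ℤ.+ Σ0ℤ p F
  split = trans (sym (Σ0ℤ-*ˡ p (+ (2 ℕ.+ p)) _))
                (trans (Σ0ℤ-cong p (λ _ → factorial-split)) (Σ0ℤ-distrib-+ p (F ∘ suc) F))
  double : ∀ x → + 2 ℤ.* x ≡ x ℤ.+ x
  double = solve-∀
  rearrange : ∀ f a b → (f ℤ.+ a) ℤ.+ (b ℤ.+ f) ≡ (a ℤ.+ b) ℤ.+ + 2 ℤ.* f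
  rearrange = solve-∀

δ₀ : ℕ → ℤ
δ₀ zero    = + 1
δ₀ (suc _) = + 0

δ₁ : ℕ → ℤ
δ₁ zero    = + 0
δ₁ (suc m) = δ₀ m

-- the EGF coefficients of log (1 + y)
logCoeff : ℕ → ℤ
logCoeff zero    = + 0
logCoeff (suc m) = (- + 1) ^ m ℤ.* + (m !)

stirlingStep-logCoeff : ∀ k → stirlingStep logCoeff k ≡ δ₀ k
stirlingStep-logCoeff zero    = refl
stirlingStep-logCoeff (suc m) =
  trans (cong (λ t → (- + 1) ^ suc m ℤ.* t ℤ.+ + suc m ℤ.* logCoeff (suc m)) (ℤP.pos-* (suc m) (m !)))
        (cancel ((- + 1) ^ m) (+ suc m) (+ (m !)))
  where
  cancel : ∀ s k f → ((- + 1) ℤ.* s) ℤ.* (k ℤ.* f) ℤ.+ k ℤ.* (s ℤ.* f) ≡ + 0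
  cancel = solve-∀

stirlingSum-δ₀ : ∀ m → stirlingSum m δ₀ ≡ δ₀ m
stirlingSum-δ₀ zero    = refl
stirlingSum-δ₀ (suc m) = Σ0ℤ-init (suc m) _ (λ _ → refl)

stirlingSum-logCoeff : ∀ n → stirlingSum n logCoeff ≡ δ₁ n
stirlingSum-logCoeff zero    = refl
stirlingSum-logCoeff (suc m) =
  trans (stirlingSum-suc m logCoeff)
        (trans (stirlingSum-cong m (λ k _ → stirlingStep-logCoeff k)) (stirlingSum-δ₀ m))

-- (2 + y) C(y) = 2 log (1 + y), read off coefficientwise.
genocchiCoeff-recurrence : ∀ k → stirlingStep (shiftʳ genocchiCoeff) k ℤ.+ genocchiCoeff k
                                 ≡ + 2 ℤ.* logCoeff k
genocchiCoeff-recurrence zero          = refl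
genocchiCoeff-recurrence (suc zero)    = refl
genocchiCoeff-recurrence (suc (suc p)) = begin
  (c (2 ℕ.+ p) ℤ.+ P ℤ.* c (suc p)) ℤ.+ c (2 ℕ.+ p)
    ≡⟨ cong₂ (λ x y → (x ℤ.+ P ℤ.* y) ℤ.+ x) (genocchiCoeff-suc (suc p)) (genocchiCoeff-suc p) ⟩
  (((- + 1) ℤ.* s) ℤ.* B′ ℤ.+ P ℤ.* (s ℤ.* B)) ℤ.+ ((- + 1) ℤ.* s) ℤ.* B′
    ≡⟨ collect s B′ P B ⟩
  ((- + 1) ℤ.* s) ℤ.* (+ 2 ℤ.* B′) ℤ.+ P ℤ.* (s ℤ.* B)
    ≡⟨ cong (λ t → ((- + 1) ℤ.* s) ℤ.* t ℤ.+ P ℤ.* (s ℤ.* B)) (factorialConvolution-suc p) ⟩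
  ((- + 1) ℤ.* s) ℤ.* (P ℤ.* B ℤ.+ + 2 ℤ.* F) ℤ.+ P ℤ.* (s ℤ.* B)
    ≡⟨ cancel s P B F ⟩
  + 2 ℤ.* (((- + 1) ℤ.* s) ℤ.* F)
    ∎
  where
  c : ℕ → ℤ
  c = genocchiCoeff
  s B′ B P F : ℤ
  s  = (- + 1) ^ p
  B′ = factorialConvolution (suc p)
  B  = factorialConvolution p
  P  = + (2 ℕ.+ p)
  F  = + (suc p !)
  collect : ∀ s b′ p b → (((- + 1) ℤ.* s) ℤ.* b′ ℤ.+ p ℤ.* (s ℤ.* b)) ℤ.+ ((- + 1) ℤ.* s) ℤ.* b′
                         ≡ ((- + 1) ℤ.* s) ℤ.* (+ 2 ℤ.* b′) ℤ.+ p ℤ.* (s ℤ.* b)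
  collect = solve-∀
  cancel : ∀ s p b f → ((- + 1) ℤ.* s) ℤ.* (p ℤ.* b ℤ.+ + 2 ℤ.* f) ℤ.+ p ℤ.* (s ℤ.* b)
                       ≡ + 2 ℤ.* (((- + 1) ℤ.* s) ℤ.* f)
  cancel = solve-∀

_⋆ℤ_ : (ℕ → ℤ) → (ℕ → ℤ) → ℕ → ℤ
(a ⋆ℤ b) n = Σ0ℤ n (λ i → + (n C i) ℤ.* a i ℤ.* b (n ∸ i))

expPlusOneℤ : ℕ → ℤ
expPlusOneℤ i = + 1 ℤ.+ δ₀ i

genocchiStirling : ℕ → ℤ
genocchiStirling m = stirlingSum m genocchiCoeff

expPlusOneℤ⋆genocchiStirling : ∀ n → (expPlusOneℤ ⋆ℤ genocchiStirling) n ≡ + 2 ℤ.* δ₁ n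
expPlusOneℤ⋆genocchiStirling n = begin
  (expPlusOneℤ ⋆ℤ Γ) n
    ≡⟨ Σ0ℤ-cong′ n (λ i → distrib (+ (n C i)) (δ₀ i) (Γ (n ∸ i))) ⟩
  Σ0ℤ n (λ i → + (n C i) ℤ.* Γ (n ∸ i) ℤ.+ δ₀ i ℤ.* (+ (n C i) ℤ.* Γ (n ∸ i)))
    ≡⟨ Σ0ℤ-distrib-+ n _ _ ⟩
  binomialSum n (λ i → Γ (n ∸ i)) ℤ.+ Σ0ℤ n (λ i → δ₀ i ℤ.* (+ (n C i) ℤ.* Γ (n ∸ i)))
    ≡⟨ cong₂ ℤ._+_ (binomialSum-reverse n Γ) (trans (Σ0ℤ-init n _ (λ _ → refl)) (unit (Γ n))) ⟩
  binomialSum n Γ ℤ.+ Γ n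
    ≡⟨ cong (ℤ._+ Γ n) (trans (binomialSum-stirlingSum n c) (stirlingSum-suc n (shiftʳ c))) ⟩
  stirlingSum n (stirlingStep (shiftʳ c)) ℤ.+ stirlingSum n c
    ≡⟨ stirlingSum-distrib-+ n (stirlingStep (shiftʳ c)) c ⟨
  stirlingSum n (λ k → stirlingStep (shiftʳ c) k ℤ.+ c k)
    ≡⟨ stirlingSum-cong n (λ k _ → genocchiCoeff-recurrence k) ⟩
  stirlingSum n (λ k → + 2 ℤ.* logCoeff k)
    ≡⟨ stirlingSum-*ˡ n (+ 2) logCoeff ⟩
  + 2 ℤ.* stirlingSum n logCoeff
    ≡⟨ cong (ℤ._*_ (+ 2)) (stirlingSum-logCoeff n) ⟩
  + 2 ℤ.* δ₁ n
    ∎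
  where
  c : ℕ → ℤ
  c = genocchiCoeff
  Γ : ℕ → ℤ
  Γ = genocchiStirling
  distrib : ∀ b d g → b ℤ.* (+ 1 ℤ.+ d) ℤ.* g ≡ b ℤ.* g ℤ.+ d ℤ.* (b ℤ.* g)
  distrib = solve-∀
  unit : ∀ g → + 1 ℤ.* (+ 1 ℤ.* g) ≡ g
  unit = solve-∀

toℚᵘ-toℚ : ∀ z → ℚ.toℚᵘ (toℚ z) ℚᵘ.≃ ℚᵘ.mkℚᵘ z 0
toℚᵘ-toℚ z = ℚP.toℚᵘ-fromℚᵘ (ℚᵘ.mkℚᵘ z 0)

-- Both sides are computed in ℚᵘ, where toℚ z is simply z/1.
toℚ-+ : ∀ a b → toℚ (a ℤ.+ b) ≡ toℚ a ℚ.+ toℚ b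
toℚ-+ a b = ℚP.toℚᵘ-injective (ℚᵘP.≃-trans (toℚᵘ-toℚ (a ℤ.+ b)) (ℚᵘP.≃-trans (ℚᵘ.*≡* (scale a b))
  (ℚᵘP.≃-sym (ℚᵘP.≃-trans (ℚP.toℚᵘ-homo-+ (toℚ a) (toℚ b)) (ℚᵘP.+-cong (toℚᵘ-toℚ a) (toℚᵘ-toℚ b))))))
  where
  scale : ∀ a b → (a ℤ.+ b) ℤ.* + 1 ≡ (a ℤ.* + 1 ℤ.+ b ℤ.* + 1) ℤ.* + 1
  scale = solve-∀

toℚ-* : ∀ a b → toℚ (a ℤ.* b) ≡ toℚ a ℚ.* toℚ b
toℚ-* a b = ℚP.toℚᵘ-injective (ℚᵘP.≃-trans (toℚᵘ-toℚ (a ℤ.* b))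
  (ℚᵘP.≃-sym (ℚᵘP.≃-trans (ℚP.toℚᵘ-homo-* (toℚ a) (toℚ b)) (ℚᵘP.*-cong (toℚᵘ-toℚ a) (toℚᵘ-toℚ b)))))

toℚ-Σ0ℤ : ∀ n (f : ℕ → ℤ) → toℚ (Σ0ℤ n f) ≡ Σ0ℚ n (toℚ ∘ f)
toℚ-Σ0ℤ zero    f = refl
toℚ-Σ0ℤ (suc n) f = trans (toℚ-+ (Σ0ℤ n f) (f (suc n))) (cong (ℚ._+ toℚ (f (suc n))) (toℚ-Σ0ℤ n f))

toℚ-⋆ℤ : ∀ a b n → toℚ ((a ⋆ℤ b) n) ≡ ((toℚ ∘ a) ⋆ (toℚ ∘ b)) n
toℚ-⋆ℤ a b n = trans (toℚ-Σ0ℤ n _) (Σ0ℚ-cong n term)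
  where
  term : ∀ i → toℚ (+ (n C i) ℤ.* a i ℤ.* b (n ∸ i)) ≡ toℚ (+ (n C i)) ℚ.* toℚ (a i) ℚ.* toℚ (b (n ∸ i))
  term i = trans (toℚ-* (+ (n C i) ℤ.* a i) (b (n ∸ i))) (cong (ℚ._* toℚ (b (n ∸ i))) (toℚ-* (+ (n C i)) (a i)))

expPlusOne≡toℚ : ∀ i → expPlusOne i ≡ toℚ (expPlusOneℤ i)
expPlusOne≡toℚ zero    = refl
expPlusOne≡toℚ (suc i) = refl

twoX≡toℚ : ∀ n → twoX n ≡ toℚ (+ 2 ℤ.* δ₁ n)
twoX≡toℚ zero          = refl
twoX≡toℚ (suc zero)    = refl
twoX≡toℚ (suc (suc n)) = refl

isGenocchi-genocchiStirling : IsGenocchi (toℚ ∘ genocchiStirling)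
isGenocchi-genocchiStirling n = begin
  (expPlusOne ⋆ (toℚ ∘ genocchiStirling)) n
    ≡⟨ Σ0ℚ-cong n (λ i → cong (λ t → toℚ (+ (n C i)) ℚ.* t ℚ.* toℚ (genocchiStirling (n ∸ i)))
                                   (expPlusOne≡toℚ i)) ⟩
  ((toℚ ∘ expPlusOneℤ) ⋆ (toℚ ∘ genocchiStirling)) n
    ≡⟨ toℚ-⋆ℤ expPlusOneℤ genocchiStirling n ⟨
  toℚ ((expPlusOneℤ ⋆ℤ genocchiStirling) n)
    ≡⟨ cong toℚ (expPlusOneℤ⋆genocchiStirling n) ⟩
  toℚ (+ 2 ℤ.* δ₁ n)
    ≡⟨ twoX≡toℚ n ⟨
  twoX n
    ∎

*-cancelˡ-≡ : ∀ p {x y} .{{_ : ℚ.NonZero p}} → p ℚ.* x ≡ p ℚ.* y → x ≡ y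
*-cancelˡ-≡ p {x} {y} px≡py = begin
  x                        ≡⟨ ℚP.*-identityˡ x ⟨
  1ℚ ℚ.* x                 ≡⟨ cong (ℚ._* x) (ℚP.*-inverseˡ p) ⟨
  ℚ.1/ p ℚ.* p ℚ.* x       ≡⟨ ℚP.*-assoc (ℚ.1/ p) p x ⟩
  ℚ.1/ p ℚ.* (p ℚ.* x)     ≡⟨ cong (ℚ._*_ (ℚ.1/ p)) px≡py ⟩
  ℚ.1/ p ℚ.* (p ℚ.* y)     ≡⟨ ℚP.*-assoc (ℚ.1/ p) p y ⟨
  ℚ.1/ p ℚ.* p ℚ.* y       ≡⟨ cong (ℚ._* y) (ℚP.*-inverseˡ p) ⟩
  1ℚ ℚ.* y                 ≡⟨ ℚP.*-identityˡ y ⟩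
  y                        ∎

⋆-cancelˡ : ∀ a .{{_ : ℚ.NonZero (a 0)}} {G H : ℕ → ℚ} →
            (∀ n → (a ⋆ G) n ≡ (a ⋆ H) n) → ∀ n → G n ≡ H n
⋆-cancelˡ a {G} {H} a⋆G≗a⋆H = <-rec (λ n → G n ≡ H n) (λ n ih → *-cancelˡ-≡ (a 0) (heads n ih (a⋆G≗a⋆H n)))
  where
  term : (ℕ → ℚ) → ℕ → ℕ → ℚ
  term X n i = toℚ (+ (n C i)) ℚ.* a i ℚ.* X (n ∸ i)
  strip : ∀ x → 1ℚ ℚ.* a 0 ℚ.* x ≡ a 0 ℚ.* x
  strip x = cong (ℚ._* x) (ℚP.*-identityˡ (a 0))
  heads : ∀ n → (∀ {m} → m < n → G m ≡ H m) → (a ⋆ G) n ≡ (a ⋆ H) n → a 0 ℚ.* G n ≡ a 0 ℚ.* H n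
  heads zero    _  eq = trans (sym (strip (G 0))) (trans eq (strip (H 0)))
  heads (suc n) ih eq = trans (sym (strip (G (suc n)))) (trans (∙-cancelʳ tail _ _ eq′) (strip (H (suc n))))
    where
    tail : ℚ
    tail = Σ0ℚ n (term G (suc n) ∘ suc)
    same-tail : tail ≡ Σ0ℚ n (term H (suc n) ∘ suc)
    same-tail = Σ0ℚ-cong n (λ i → cong (λ t → toℚ (+ (suc n C suc i)) ℚ.* a (suc i) ℚ.* t)
                                       (ih (s≤s (ℕP.m∸n≤m n i))))
    eq′ : term G (suc n) 0 ℚ.+ tail ≡ term H (suc n) 0 ℚ.+ tail
    eq′ = begin
      term G (suc n) 0 ℚ.+ tail                               ≡⟨ Σ0ℚ-head n (term G (suc n)) ⟨
      (a ⋆ G) (suc n)                                         ≡⟨ eq ⟩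
      (a ⋆ H) (suc n)                                         ≡⟨ Σ0ℚ-head n (term H (suc n)) ⟩
      term H (suc n) 0 ℚ.+ Σ0ℚ n (term H (suc n) ∘ suc)       ≡⟨ cong (ℚ._+_ (term H (suc n) 0)) same-tail ⟨
      term H (suc n) 0 ℚ.+ tail                               ∎

theorem1 : (G : ℕ → ℚ) (S : ℕ → ℕ → ℤ) → IsGenocchi G → IsStirling2 S →
    ∀ (n : ℕ) → G n ≡ toℚ (genocchiRHS S n)
theorem1 G S isG isS n = begin
  G n                              ≡⟨ ⋆-cancelˡ expPlusOne {G} {toℚ ∘ genocchiStirling} same-product n ⟩
  toℚ (genocchiStirling n)         ≡⟨ cong toℚ (genocchiRHS≡stirlingSum {S} isS n) ⟨
  toℚ (genocchiRHS S n)            ∎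
  where
  same-product : ∀ m → (expPlusOne ⋆ G) m ≡ (expPlusOne ⋆ (toℚ ∘ genocchiStirling)) m
  same-product m = trans (isG m) (sym (isGenocchi-genocchiStirling m))
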